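{- Let $A$ be a partial combinatory algebra and let $f:A\rightharpoonup A$ be a partial function. Then there exist a partial combinatory algebra $A[f]$ and a decidable applicative morphism $\iota_f:A\to A[f]$ with the following properties: (i) $f$ is representable with respect to $\iota_f$; (ii) for every partial combinatory algebra $B$ and every decidable applicative morphism $\gamma:A\to B$ such that $f$ is representable with respect to $\gamma$, there is a decidable applicative morphism $\gamma_f:A[f]\to B$ such that $\gamma_f\iota_f=\gamma$ (equality of applicative morphisms), and $\gamma_f$ is the unique applicative morphism $A[f]\to B$ with this property. Moreover, if $\delta:A[f]\to B$ is any applicative morphism with $\delta\iota_f\cong\gamma$, then $\delta\cong\gamma_f$.
   Context: A partial combinatory algebra (pca) is a set $A$ with a partial binary operation (application) $(a,b)\mapsto ab$, written left-associatively, such that there exist $K,S\in A$ with $Kab=a$, $Sab$ defined, and $Sabc\simeq ac(bc)$ for all $a,b,c$ (here $\simeq$ means one side is defined iff the other is, and then they are equal; definedness of a compound term includes definedness of all subterms). Every pca has chosen Booleans $\top,\bot$. An applicative morphism $\gamma:A\to B$ between pcas is a function from $A$ to the set of nonempty subsets of $B$ such that there is $r\in B$ (a realizer) with: whenever $aa'$ is defined in $A$, $b\in\gamma(a)$ and $b'\in\gamma(a')$, then $rbb'$ is defined and $rbb'\in\gamma(aa')$. Composition of $\gamma:A\to B$ and $\delta:B\to C$ is $\delta\gamma(a)=\bigcup_{b\in\gamma(a)}\delta(b)$; identities are $a\mapsto\{a\}$. For $\gamma,\delta:A\to B$, write $\gamma\preceq\delta$ if there is $s\in B$ with $sb\in\delta(a)$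 (in particular defined) for all $a\in A$, $b\in\gamma(a)$; $\gamma\cong\delta$ means $\gamma\preceq\delta$ and $\delta\preceq\gamma$. An applicative morphism $\gamma:A\to B$ is decidable if there is $d\in B$ such that $db=\top_B$ for all $b\in\gamma(\top_A)$ and $db=\bot_B$ for all $b\in\gamma(\bot_A)$. A partial function $f:A\rightharpoonup A$ is representable with respect to an applicative morphism $\gamma:A\to B$ if there is $r_f\in B$ such that for every $a\in\mathrm{dom}(f)$ and every $b\in\gamma(a)$, $r_fb$ is defined and $r_fb\in\gamma(f(a))$. -}

module Defs where

open import Data.Product using (Σ; Σ-syntax; ∃; _×_; _,_; proj₁; proj₂)
open import Relation.Binary.PropositionalEquality using (_≡_)

-- Application is a partial binary operation,
-- represented as its graph  App a b c  ("a b is defined and equals c"),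
-- which is required to be functional.
record PCA : Set₁ where
  field
    Carrier : Set
    App     : Carrier → Carrier → Carrier → Set
    App-functional : ∀ {a b c c'} → App a b c → App a b c' → c ≡ c'
    K S     : Carrier
    K-law   : ∀ a b → Σ[ k ∈ Carrier ] (App K a k × App k b a)
    S-def   : ∀ a b → Σ[ s ∈ Carrier ] Σ[ t ∈ Carrier ] (App S a s × App s b t)
    -- S a b c ≃ a c (b c)  (Kleene equality)
    S-law   : ∀ a b c v →
      ((Σ[ s ∈ Carrier ] Σ[ t ∈ Carrier ] (App S a s × App s b t × App t c v))
        → (Σ[ x ∈ Carrier ] Σ[ y ∈ Carrier ] (App a c x × App b c y × App x y v)))
      × ((Σ[ x ∈ Carrier ] Σ[ y ∈ Carrier ] (App a c x × App b c y × App x y v))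
        → (Σ[ s ∈ Carrier ] Σ[ t ∈ Carrier ] (App S a s × App s b t × App t c v)))

  I : Carrier
  I = proj₁ (proj₂ (S-def K K))

  true false : Carrier
  true  = K
  false = proj₁ (K-law I I)

open PCA public

record PartialFn (A : PCA) : Set₁ where
  field
    graph      : Carrier A → Carrier A → Set
    functional : ∀ {a b b'} → graph a b → graph a b' → b ≡ b'

open PartialFn public

Rel : PCA → PCA → Set₁
Rel A B = Carrier A → Carrier B → Set

record AppMor (A B : PCA) : Set₁ where
  field
    rel      : Rel A B
    nonempty : ∀ a → ∃ λ b → rel a b
    realizer : Σ[ r ∈ Carrier B ] (∀ a a' c b b' → App A a a' c → rel a b → rel a' b' →
                 Σ[ x ∈ Carrier B ] Σ[ y ∈ Carrier B ] (App B r b x × App B x b' y × rel c y))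

open AppMor public

_∘R_ : {A B C : PCA} → Rel B C → Rel A B → Rel A C
_∘R_ {B = B} δ γ a c = Σ[ b ∈ Carrier B ] (γ a b × δ b c)

_≡R_ : {A B : PCA} → Rel A B → Rel A B → Set
_≡R_ {A} {B} γ δ = ∀ a b → (γ a b → δ a b) × (δ a b → γ a b)

_≼_ : {A B : PCA} → Rel A B → Rel A B → Set
_≼_ {A} {B} γ δ = Σ[ s ∈ Carrier B ] (∀ a b → γ a b → Σ[ c ∈ Carrier B ] (App B s b c × δ a c))

_≅_ : {A B : PCA} → Rel A B → Rel A B → Set
_≅_ {A} {B} γ δ = (_≼_ {A} {B} γ δ) × (_≼_ {A} {B} δ γ)

Decidable : {A B : PCA} → AppMor A B → Set
Decidable {A} {B} γ = Σ[ d ∈ Carrier B ]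
  ((∀ b → rel γ (true A) b → App B d b (true B)) × (∀ b → rel γ (false A) b → App B d b (false B)))

Representable : {A B : PCA} → PartialFn A → AppMor A B → Set
Representable {A} {B} f γ = Σ[ r ∈ Carrier B ]
  (∀ a fa b → graph f a fa → rel γ a b → Σ[ c ∈ Carrier B ] (App B r b c × rel γ fa c))

{-# OPTIONS --safe #-}
module Submission where

-- A[f] has the carrier of A.  An element r of A is read as a dialogue with the oracle f: it
-- returns a value c, or asks for f(x) and continues with k · f(x), or runs a subdialogue r₁
-- and continues with g applied to its result.  In A[f], a · b = c means that the A-application
-- a · b is a dialogue returning c; K and S of A[f] are combinators of A that return at once
-- (the S-law threads two subdialogues), ι is the identity and f is realised by a one-question
-- dialogue.  Given a decidable γ : A → B representing f, a fixed point in B gives an interpreter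
-- of γ-codes of dialogues: decidability lets it branch on the tags, the realizer of γ simulates
-- A-application and the representer of f answers the questions.  So γ itself is an applicative
-- morphism A[f] → B, and as ι is the identity, any δ with δι = γ (or ≅ γ) equals (or is ≅ to) it.

open import Defs
open import Data.Nat using (ℕ; zero; suc)
open import Data.Fin using (Fin; zero; suc)
open import Data.Vec using (Vec; []; _∷_; lookup)
open import Data.Product using (Σ; Σ-syntax; _×_; _,_; proj₁; proj₂)
open import Relation.Binary.PropositionalEquality using (_≡_; refl; subst)

module Combinators (P : PCA) where

  private
    C : Set
    C = Carrier P

  infix 4 _·_⇓_ _·_·_⇓_ _⇓⟨_,_⟩

  _·_⇓_ : C → C → C → Set
  _·_⇓_ = App P

  _·_·_⇓_ : C → C → C → C → Set
  a · b · c ⇓ w = Σ[ x ∈ C ] (a · b ⇓ x × x · c ⇓ w)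

  ·-functional : ∀ {a b c c'} → a · b ⇓ c → a · b ⇓ c' → c ≡ c'
  ·-functional = App-functional P

  ·₂-functional : ∀ {a b c w w'} → a · b · c ⇓ w → a · b · c ⇓ w' → w ≡ w'
  ·₂-functional (x , ab⇓x , xc⇓w) (x' , ab⇓x' , x'c⇓w') with ·-functional ab⇓x ab⇓x'
  ... | refl = ·-functional xc⇓w x'c⇓w'

  K-reduces : ∀ a b → K P · a · b ⇓ a
  K-reduces = K-law P

  K-result : ∀ {a b w} → K P · a · b ⇓ w → w ≡ a
  K-result K·a·b⇓w = ·₂-functional K·a·b⇓w (K-reduces _ _)

  K₁ : C → C
  K₁ a = proj₁ (K-law P a a)

  K-K₁ : ∀ a → K P · a ⇓ K₁ a
  K-K₁ a = proj₁ (proj₂ (K-law P a a))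

  K₁-reduces : ∀ a b → K₁ a · b ⇓ a
  K₁-reduces a b with K-reduces a b
  ... | k , Ka⇓k , kb⇓a with ·-functional Ka⇓k (K-K₁ a)
  ... | refl = kb⇓a

  S₂ : C → C → C
  S₂ a b = proj₁ (proj₂ (S-def P a b))

  S₂-reduces : ∀ {a b c x y w} → a · c ⇓ x → b · c ⇓ y → x · y ⇓ w → S₂ a b · c ⇓ w
  S₂-reduces {a} {b} {c} {x} {y} {w} ac bc xy
    with proj₂ (S-law P a b c w) (x , y , ac , bc , xy) | S-def P a b
  ... | s , t , Sa⇓s , sb⇓t , tc⇓w | s' , t' , Sa⇓s' , sb⇓t'
    with ·-functional Sa⇓s Sa⇓s'
  ... | refl with ·-functional sb⇓t sb⇓t'
  ... | refl = tc⇓w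

  S₂-result : ∀ {a b c w} → S₂ a b · c ⇓ w → Σ[ x ∈ C ] Σ[ y ∈ C ] (a · c ⇓ x × b · c ⇓ y × x · y ⇓ w)
  S₂-result {a} {b} {c} {w} S₂c⇓w with S-def P a b
  ... | s , t , Sa⇓s , sb⇓t = proj₁ (S-law P a b c w) (s , t , Sa⇓s , sb⇓t , S₂c⇓w)

  I-reduces : ∀ a → I P · a ⇓ a
  I-reduces a = S₂-reduces (K-K₁ a) (K-K₁ a) (K₁-reduces a (K₁ a))

  I-result : ∀ {a w} → I P · a ⇓ w → w ≡ a
  I-result I·a⇓w with S₂-result I·a⇓w
  ... | x , y , Ka⇓x , _ , xy⇓w = K-result (x , Ka⇓x , xy⇓w)

  true-reduces : ∀ a b → true P · a · b ⇓ a
  true-reduces = K-reduces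

  false-reduces : ∀ a b → false P · a · b ⇓ b
  false-reduces a b = I P , K₁-reduces (I P) a , I-reduces b

  false-result : ∀ {a b w} → false P · a · b ⇓ w → w ≡ b
  false-result F·a·b⇓w = ·₂-functional F·a·b⇓w (false-reduces _ _)

  degenerate : true P ≡ false P → ∀ a b → a ≡ b
  degenerate t≡f a b = false-result (subst (λ t → t · a · b ⇓ a) t≡f (true-reduces a b))

  degenerate-· : true P ≡ false P → ∀ a b c → a · b ⇓ c
  degenerate-· t≡f a b c
    with degenerate t≡f a (K P) | degenerate t≡f b (K P) | degenerate t≡f c (K₁ (K P))
  ... | refl | refl | refl = K-K₁ (K P)

  private variable
    n : ℕ

  infixl 7 _∙_
  data Term (n : ℕ) : Set where
    var : Fin n → Term n
    con : C → Term n
    _∙_ : Term n → Term n → Term n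

  v0 : Term (suc n)
  v0 = var zero
  v1 : Term (suc (suc n))
  v1 = var (suc zero)
  v2 : Term (suc (suc (suc n)))
  v2 = var (suc (suc zero))

  private variable
    ρ : Vec C n

  infix 4 _⊢_⇓_
  data _⊢_⇓_ (ρ : Vec C n) : Term n → C → Set where
    ⇓var : ∀ i → ρ ⊢ var i ⇓ lookup ρ i
    ⇓con : ∀ c → ρ ⊢ con c ⇓ c
    ⇓app : ∀ {t s x y w} → ρ ⊢ t ⇓ x → ρ ⊢ s ⇓ y → x · y ⇓ w → ρ ⊢ t ∙ s ⇓ w

  ⇓-functional : ∀ {t w w'} → ρ ⊢ t ⇓ w → ρ ⊢ t ⇓ w' → w ≡ w'
  ⇓-functional (⇓var i) (⇓var .i) = refl
  ⇓-functional (⇓con c) (⇓con .c) = refl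
  ⇓-functional (⇓app t⇓x s⇓y xy⇓w) (⇓app t⇓x' s⇓y' xy⇓w')
    with ⇓-functional t⇓x t⇓x' | ⇓-functional s⇓y s⇓y'
  ... | refl | refl = ·-functional xy⇓w xy⇓w'

  weaken : Term n → Term (suc n)
  weaken (var i) = var (suc i)
  weaken (con c) = con c
  weaken (t ∙ s) = weaken t ∙ weaken s

  ⇓-weaken : ∀ {t w} a → ρ ⊢ t ⇓ w → a ∷ ρ ⊢ weaken t ⇓ w
  ⇓-weaken a (⇓var i) = ⇓var (suc i)
  ⇓-weaken a (⇓con c) = ⇓con c
  ⇓-weaken a (⇓app t⇓x s⇓y xy⇓w) = ⇓app (⇓-weaken a t⇓x) (⇓-weaken a s⇓y) xy⇓w

  -- Opaque, so that types mention closures rather than their large combinator normal forms.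
  opaque
    ƛ : Term (suc n) → Term n
    ƛ (var zero) = con (I P)
    ƛ (var (suc i)) = con (K P) ∙ var i
    ƛ (con c) = con (K P) ∙ con c
    ƛ (t ∙ s) = con (S P) ∙ ƛ t ∙ ƛ s

    closure : Term (suc n) → Vec C n → C
    closure (var zero) ρ = I P
    closure (var (suc i)) ρ = K₁ (lookup ρ i)
    closure (con c) ρ = K₁ c
    closure (t ∙ s) ρ = S₂ (closure t ρ) (closure s ρ)

    ⇓-ƛ : (t : Term (suc n)) (ρ : Vec C n) → ρ ⊢ ƛ t ⇓ closure t ρ
    ⇓-ƛ (var zero) ρ = ⇓con (I P)
    ⇓-ƛ (var (suc i)) ρ = ⇓app (⇓con (K P)) (⇓var i) (K-K₁ (lookup ρ i))
    ⇓-ƛ (con c) ρ = ⇓app (⇓con (K P)) (⇓con c) (K-K₁ c)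
    ⇓-ƛ (t ∙ s) ρ with S-def P (closure t ρ) (closure s ρ)
    ... | _ , _ , S·x , S·x·y = ⇓app (⇓app (⇓con (S P)) (⇓-ƛ t ρ) S·x) (⇓-ƛ s ρ) S·x·y

    closure-reduces : ∀ {t : Term (suc n)} {ρ a w} → a ∷ ρ ⊢ t ⇓ w → closure t ρ · a ⇓ w
    closure-reduces {t = var zero} (⇓var zero) = I-reduces _
    closure-reduces {t = var (suc i)} (⇓var (suc i)) = K₁-reduces _ _
    closure-reduces (⇓con c) = K₁-reduces c _
    closure-reduces (⇓app t⇓x s⇓y xy⇓w) =
      S₂-reduces (closure-reduces t⇓x) (closure-reduces s⇓y) xy⇓w

    closure-result : (t : Term (suc n)) (ρ : Vec C n) → ∀ {a w} → closure t ρ · a ⇓ w → a ∷ ρ ⊢ t ⇓ w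
    closure-result (var zero) ρ I·a⇓w with I-result I·a⇓w
    ... | refl = ⇓var zero
    closure-result (var (suc i)) ρ k·a⇓w with K-result (_ , K-K₁ (lookup ρ i) , k·a⇓w)
    ... | refl = ⇓var (suc i)
    closure-result (con c) ρ k·a⇓w with K-result (_ , K-K₁ c , k·a⇓w)
    ... | refl = ⇓con c
    closure-result (t ∙ s) ρ S₂·a⇓w with S₂-result S₂·a⇓w
    ... | x , y , ta⇓x , sa⇓y , xy⇓w =
      ⇓app (closure-result t ρ ta⇓x) (closure-result s ρ sa⇓y) xy⇓w

  closure-curry : (t : Term (suc (suc n))) (ρ : Vec C n) (a : C) → closure (ƛ t) ρ · a ⇓ closure t (a ∷ ρ)
  closure-curry t ρ a = closure-reduces (⇓-ƛ t (a ∷ ρ))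

  closure₂-reduces : ∀ {t : Term (suc (suc n))} {ρ : Vec C n} {a b w} →
    b ∷ a ∷ ρ ⊢ t ⇓ w → closure (ƛ t) ρ · a · b ⇓ w
  closure₂-reduces {t = t} {ρ} {a} t⇓w = closure t (a ∷ ρ) , closure-curry t ρ a , closure-reduces t⇓w

  ⇓app₂ : ∀ {t s u x y z w} →
    ρ ⊢ t ⇓ x → ρ ⊢ s ⇓ y → ρ ⊢ u ⇓ z → x · y · z ⇓ w → ρ ⊢ t ∙ s ∙ u ⇓ w
  ⇓app₂ t⇓x s⇓y u⇓z (_ , xy⇓ , ⇓w) = ⇓app (⇓app t⇓x s⇓y xy⇓) u⇓z ⇓w

  _⇓⟨_,_⟩ : C → C → C → Set
  r ⇓⟨ x , y ⟩ = r · true P ⇓ x × r · false P ⇓ y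

  ⇓⟨⟩-functional : ∀ {r x y x' y'} → r ⇓⟨ x , y ⟩ → r ⇓⟨ x' , y' ⟩ → x ≡ x' × y ≡ y'
  ⇓⟨⟩-functional (rt⇓x , rf⇓y) (rt⇓x' , rf⇓y') = ·-functional rt⇓x rt⇓x' , ·-functional rf⇓y rf⇓y'

  private
    pairing : Term 3
    pairing = v0 ∙ v2 ∙ v1

  pair : C
  pair = closure (ƛ (ƛ pairing)) []

  ⟨_,_⟩ : C → C → C
  ⟨ p , q ⟩ = closure pairing (q ∷ p ∷ [])

  pair-reduces : ∀ p q → pair · p · q ⇓ ⟨ p , q ⟩
  pair-reduces p q = closure₂-reduces (⇓-ƛ pairing (q ∷ p ∷ []))

  ⟨,⟩-⇓ : ∀ {p q} → ⟨ p , q ⟩ ⇓⟨ p , q ⟩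
  ⟨,⟩-⇓ {p} {q} = closure-reduces (select (true-reduces p q)) , closure-reduces (select (false-reduces p q))
    where
      select : ∀ {z w} → z · p · q ⇓ w → z ∷ q ∷ p ∷ [] ⊢ pairing ⇓ w
      select = ⇓app₂ (⇓var zero) (⇓var (suc (suc zero))) (⇓var (suc zero))

  ⟪_,_⟫ : Term n → Term n → Term n
  ⟪ t , u ⟫ = con pair ∙ t ∙ u

  ⇓-⟪⟫ : ∀ {t u p q} → ρ ⊢ t ⇓ p → ρ ⊢ u ⇓ q → ρ ⊢ ⟪ t , u ⟫ ⇓ ⟨ p , q ⟩
  ⇓-⟪⟫ t⇓p u⇓q = ⇓app₂ (⇓con pair) t⇓p u⇓q (pair-reduces _ _)

  ⇓-⟪⟫-result : ∀ {t u w} → ρ ⊢ ⟪ t , u ⟫ ⇓ w →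
    Σ[ p ∈ C ] Σ[ q ∈ C ] (ρ ⊢ t ⇓ p × ρ ⊢ u ⇓ q × w ≡ ⟨ p , q ⟩)
  ⇓-⟪⟫-result (⇓app (⇓app (⇓con _) t⇓p pair·p⇓x) u⇓q x·q⇓w) =
    _ , _ , t⇓p , u⇓q , ·₂-functional (_ , pair·p⇓x , x·q⇓w) (pair-reduces _ _)

  -- The branches are abstracted over a dummy argument, so only the selected one is evaluated.
  infix 0 if_then_else_
  opaque
    if_then_else_ : Term n → Term n → Term n → Term n
    if b then t else u = b ∙ ƛ (weaken t) ∙ ƛ (weaken u) ∙ con (I P)

    ⇓-if-true : ∀ {b t u w} → ρ ⊢ b ⇓ true P → ρ ⊢ t ⇓ w → ρ ⊢ if b then t else u ⇓ w
    ⇓-if-true {ρ = ρ} {t = t} {u} b⇓true t⇓w =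
      ⇓app (⇓app₂ b⇓true (⇓-ƛ (weaken t) ρ) (⇓-ƛ (weaken u) ρ) (true-reduces _ _)) (⇓con (I P))
           (closure-reduces (⇓-weaken (I P) t⇓w))

    ⇓-if-false : ∀ {b t u w} → ρ ⊢ b ⇓ false P → ρ ⊢ u ⇓ w → ρ ⊢ if b then t else u ⇓ w
    ⇓-if-false {ρ = ρ} {t = t} {u} b⇓false u⇓w =
      ⇓app (⇓app₂ b⇓false (⇓-ƛ (weaken t) ρ) (⇓-ƛ (weaken u) ρ) (false-reduces _ _)) (⇓con (I P))
           (closure-reduces (⇓-weaken (I P) u⇓w))

  -- fix g = λ a. g (W W g) a with W = λ w g a. g (w w g) a: the abstraction over a delays the
  -- self-application, so fix g is defined in every pca.
  private
    turing : Term 3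
    turing = v1 ∙ (v2 ∙ v2 ∙ v1) ∙ v0

    W : C
    W = closure (ƛ (ƛ turing)) []

  fix : C → C
  fix g = closure turing (g ∷ W ∷ [])

  fix-reduces : ∀ {g h a w} → g · fix g ⇓ h → h · a ⇓ w → fix g · a ⇓ w
  fix-reduces {g} g·fix⇓h h·a⇓w =
    closure-reduces (⇓app (⇓app (⇓var (suc zero)) WWg⇓fix g·fix⇓h) (⇓var zero) h·a⇓w)
    where
      WWg⇓fix : ∀ {a} → a ∷ g ∷ W ∷ [] ⊢ v2 ∙ v2 ∙ v1 ⇓ fix g
      WWg⇓fix = ⇓app₂ (⇓var _) (⇓var _) (⇓var _) (closure₂-reduces (⇓-ƛ turing (g ∷ W ∷ [])))

  recursive : Term 2 → C
  recursive t = fix (closure (ƛ t) [])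

  recursive-reduces : ∀ {t a w} → a ∷ recursive t ∷ [] ⊢ t ⇓ w → recursive t · a ⇓ w
  recursive-reduces {t} t⇓w = fix-reduces (closure-curry t [] (recursive t)) (closure-reduces t⇓w)

module Oracle (A : PCA) (f : PartialFn A) where

  open Combinators A

  private
    C : Set
    C = Carrier A

  private variable
    n : ℕ
    ρ : Vec C n

  -- r returns c if r ⇓⟨ true , c ⟩.  Otherwise r ⇓⟨ false , p ⟩ with p ⇓⟨ b , q ⟩ and q ⇓⟨ x , y ⟩:
  -- for b = true, r asks for f(x) and continues with y; for b = false, r runs x and continues with y.
  -- Components are read off by application, so every element behaving like a code is a dialogue.
  Node : C → C → C → C → Set
  Node r b x y = Σ[ p ∈ C ] Σ[ q ∈ C ] (r ⇓⟨ false A , p ⟩ × p ⇓⟨ b , q ⟩ × q ⇓⟨ x , y ⟩)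

  Node-functional : ∀ {r b x y b' x' y'} → Node r b x y → Node r b' x' y' → b ≡ b' × x ≡ x' × y ≡ y'
  Node-functional (p , q , r⇓ , p⇓ , q⇓) (p' , q' , r⇓' , p⇓' , q⇓')
    with proj₂ (⇓⟨⟩-functional r⇓ r⇓')
  ... | refl with ⇓⟨⟩-functional p⇓ p⇓'
  ... | b≡b' , refl with ⇓⟨⟩-functional q⇓ q⇓'
  ... | x≡x' , y≡y' = b≡b' , x≡x' , y≡y'

  returns-Node-disjoint : ∀ {r c b x y} → r ⇓⟨ true A , c ⟩ → Node r b x y → true A ≡ false A
  returns-Node-disjoint r⇓ (_ , _ , r⇓' , _) = proj₁ (⇓⟨⟩-functional r⇓ r⇓')

  infix 4 _·ᶠ_⇓_

  data Run : C → C → Set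
  _·ᶠ_⇓_ : C → C → C → Set

  a ·ᶠ b ⇓ c = Σ[ r ∈ C ] (a · b ⇓ r × Run r c)

  data Run where
    returns : ∀ {r c} → r ⇓⟨ true A , c ⟩ → Run r c
    asks    : ∀ {r x k u c} → Node r (true A) x k → graph f x u → k ·ᶠ u ⇓ c → Run r c
    binds   : ∀ {r r₁ g x c} → Node r (false A) r₁ g → Run r₁ x → g ·ᶠ x ⇓ c → Run r c

  Run-functional : ∀ {r c c'} → Run r c → Run r c' → c ≡ c'
  ·ᶠ-functional : ∀ {a b c c'} → a ·ᶠ b ⇓ c → a ·ᶠ b ⇓ c' → c ≡ c'

  Run-functional (returns r⇓) (returns r⇓') = proj₂ (⇓⟨⟩-functional r⇓ r⇓')
  Run-functional (returns r⇓) (asks n _ _) = degenerate (returns-Node-disjoint r⇓ n) _ _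
  Run-functional (returns r⇓) (binds n _ _) = degenerate (returns-Node-disjoint r⇓ n) _ _
  Run-functional (asks n _ _) (returns r⇓) = degenerate (returns-Node-disjoint r⇓ n) _ _
  Run-functional (binds n _ _) (returns r⇓) = degenerate (returns-Node-disjoint r⇓ n) _ _
  Run-functional (asks n _ _) (binds n' _ _) = degenerate (proj₁ (Node-functional n n')) _ _
  Run-functional (binds n _ _) (asks n' _ _) = degenerate (proj₁ (Node-functional n' n)) _ _
  Run-functional (asks n x↦u ku⇓c) (asks n' x↦u' ku⇓c') with Node-functional n n'
  ... | _ , refl , refl with functional f x↦u x↦u'
  ... | refl = ·ᶠ-functional ku⇓c ku⇓c'
  Run-functional (binds n R gx⇓c) (binds n' R' gx⇓c') with Node-functional n n'
  ... | _ , refl , refl with Run-functional R R'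
  ... | refl = ·ᶠ-functional gx⇓c gx⇓c'

  ·ᶠ-functional (r , ab⇓r , R) (r' , ab⇓r' , R') with ·-functional ab⇓r ab⇓r'
  ... | refl = Run-functional R R'

  ret : C → C
  ret c = ⟨ true A , c ⟩

  ask bind : C → C → C
  ask x k = ⟨ false A , ⟨ true A , ⟨ x , k ⟩ ⟩ ⟩
  bind r g = ⟨ false A , ⟨ false A , ⟨ r , g ⟩ ⟩ ⟩

  Node-⟨⟩ : ∀ b x y → Node ⟨ false A , ⟨ b , ⟨ x , y ⟩ ⟩ ⟩ b x y
  Node-⟨⟩ b x y = _ , _ , ⟨,⟩-⇓ , ⟨,⟩-⇓ , ⟨,⟩-⇓

  run-ret : ∀ {c} → Run (ret c) c
  run-ret = returns ⟨,⟩-⇓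

  run-ask : ∀ {x k u c} → graph f x u → k ·ᶠ u ⇓ c → Run (ask x k) c
  run-ask = asks (Node-⟨⟩ _ _ _)

  run-bind : ∀ {r g x c} → Run r x → g ·ᶠ x ⇓ c → Run (bind r g) c
  run-bind = binds (Node-⟨⟩ _ _ _)

  degenerate-Run : true A ≡ false A → ∀ r c → Run r c
  degenerate-Run t≡f r c = returns (degenerate-· t≡f _ _ _ , degenerate-· t≡f _ _ _)

  degenerate-·ᶠ : true A ≡ false A → ∀ a b c → a ·ᶠ b ⇓ c
  degenerate-·ᶠ t≡f a b c = a , degenerate-· t≡f a b a , degenerate-Run t≡f a c

  run-bind-result : ∀ {r g c} → Run (bind r g) c → Σ[ x ∈ C ] (Run r x × g ·ᶠ x ⇓ c)
  run-bind-result {r} {g} {c} (returns r⇓) = c , degenerate-Run t≡f r c , degenerate-·ᶠ t≡f g c c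
    where t≡f = returns-Node-disjoint r⇓ (Node-⟨⟩ _ _ _)
  run-bind-result {r} {g} {c} (asks n _ _) = c , degenerate-Run t≡f r c , degenerate-·ᶠ t≡f g c c
    where t≡f = proj₁ (Node-functional n (Node-⟨⟩ _ _ _))
  run-bind-result (binds n R gx⇓c) with Node-functional n (Node-⟨⟩ _ _ _)
  ... | _ , refl , refl = _ , R , gx⇓c

  retᵗ : Term n → Term n
  retᵗ t = ⟪ con (true A) , t ⟫

  askᵗ bindᵗ : Term n → Term n → Term n
  askᵗ t u = ⟪ con (false A) , ⟪ con (true A) , ⟪ t , u ⟫ ⟫ ⟫
  bindᵗ t u = ⟪ con (false A) , ⟪ con (false A) , ⟪ t , u ⟫ ⟫ ⟫

  ⇓-ask : ∀ {t u x k} → ρ ⊢ t ⇓ x → ρ ⊢ u ⇓ k → ρ ⊢ askᵗ t u ⇓ ask x k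
  ⇓-ask t⇓x u⇓k = ⇓-⟪⟫ (⇓con _) (⇓-⟪⟫ (⇓con _) (⇓-⟪⟫ t⇓x u⇓k))

  ⇓-bind : ∀ {t u r g} → ρ ⊢ t ⇓ r → ρ ⊢ u ⇓ g → ρ ⊢ bindᵗ t u ⇓ bind r g
  ⇓-bind t⇓r u⇓g = ⇓-⟪⟫ (⇓con _) (⇓-⟪⟫ (⇓con _) (⇓-⟪⟫ t⇓r u⇓g))

  ⇓-bind-result : ∀ {t u w} → ρ ⊢ bindᵗ t u ⇓ w →
    Σ[ r ∈ C ] Σ[ g ∈ C ] (ρ ⊢ t ⇓ r × ρ ⊢ u ⇓ g × w ≡ bind r g)
  ⇓-bind-result ⇓w with ⇓-⟪⟫-result ⇓w
  ... | _ , _ , ⇓con _ , ⇓p , refl with ⇓-⟪⟫-result ⇓p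
  ... | _ , _ , ⇓con _ , ⇓q , refl with ⇓-⟪⟫-result ⇓q
  ... | r , g , t⇓r , u⇓g , refl = r , g , t⇓r , u⇓g , refl

  ƛᶠ : Term (suc n) → Term n
  ƛᶠ t = ƛ (retᵗ t)

  closureᶠ : Term (suc n) → Vec C n → C
  closureᶠ t ρ = closure (retᵗ t) ρ

  closureᶠ-reduces : ∀ {t : Term (suc n)} {ρ a w} → a ∷ ρ ⊢ t ⇓ w → closureᶠ t ρ ·ᶠ a ⇓ w
  closureᶠ-reduces t⇓w = _ , closure-reduces (⇓-⟪⟫ (⇓con _) t⇓w) , run-ret

  closureᶠ-result : (t : Term (suc n)) (ρ : Vec C n) → ∀ {a w} → closureᶠ t ρ ·ᶠ a ⇓ w → a ∷ ρ ⊢ t ⇓ w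
  closureᶠ-result t ρ (r , ·a⇓r , R) with ⇓-⟪⟫-result (closure-result (retᵗ t) ρ ·a⇓r)
  ... | _ , c , ⇓con _ , t⇓c , refl with Run-functional R run-ret
  ... | refl = t⇓c

  closureᶠ-curry : (t : Term (suc (suc n))) (ρ : Vec C n) (a : C) →
    closureᶠ (ƛᶠ t) ρ ·ᶠ a ⇓ closureᶠ t (a ∷ ρ)
  closureᶠ-curry t ρ a = closureᶠ-reduces (⇓-ƛ (retᵗ t) (a ∷ ρ))

  bind-closure-reduces : ∀ {t u : Term (suc n)} {ρ a r x g c} →
    a ∷ ρ ⊢ t ⇓ r → Run r x → a ∷ ρ ⊢ u ⇓ g → g ·ᶠ x ⇓ c → closure (bindᵗ t u) ρ ·ᶠ a ⇓ c
  bind-closure-reduces t⇓r R u⇓g gx⇓c = _ , closure-reduces (⇓-bind t⇓r u⇓g) , run-bind R gx⇓c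

  bind-closure-result : (t u : Term (suc n)) (ρ : Vec C n) → ∀ {a c} → closure (bindᵗ t u) ρ ·ᶠ a ⇓ c →
    Σ[ r ∈ C ] Σ[ x ∈ C ] Σ[ g ∈ C ] (a ∷ ρ ⊢ t ⇓ r × Run r x × a ∷ ρ ⊢ u ⇓ g × g ·ᶠ x ⇓ c)
  bind-closure-result t u ρ (w , ·a⇓w , R) with ⇓-bind-result (closure-result (bindᵗ t u) ρ ·a⇓w)
  ... | r , g , t⇓r , u⇓g , refl with run-bind-result R
  ... | x , Rx , gx⇓c = r , x , g , t⇓r , Rx , u⇓g , gx⇓c

  private
    S-body : Term 3
    S-body = bindᵗ (v2 ∙ v0) (ƛ (bindᵗ (v2 ∙ v1) v0))

    Kᶠ Sᶠ : C
    Kᶠ = closureᶠ (ƛᶠ v1) []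
    Sᶠ = closureᶠ (ƛᶠ (ƛ S-body)) []

    S-law-result : ∀ {a b c v s t} → Sᶠ ·ᶠ a ⇓ s → s ·ᶠ b ⇓ t → t ·ᶠ c ⇓ v →
      Σ[ x ∈ C ] Σ[ y ∈ C ] (a ·ᶠ c ⇓ x × b ·ᶠ c ⇓ y × x ·ᶠ y ⇓ v)
    S-law-result {a} {b} {c} Sa⇓s sb⇓t tc⇓v
      with ⇓-functional (⇓-ƛ (retᵗ (ƛ S-body)) (a ∷ [])) (closureᶠ-result (ƛᶠ (ƛ S-body)) [] Sa⇓s)
    ... | refl with ⇓-functional (⇓-ƛ S-body (b ∷ a ∷ [])) (closureᶠ-result (ƛ S-body) (a ∷ []) sb⇓t)
    ... | refl with bind-closure-result (v2 ∙ v0) _ (b ∷ a ∷ []) tc⇓v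
    ... | r₁ , x , g , ⇓app (⇓var _) (⇓var _) ac⇓r₁ , Rx , g⇓ , gx⇓v
      with ⇓-functional (⇓-ƛ (bindᵗ (v2 ∙ v1) v0) (c ∷ b ∷ a ∷ [])) g⇓
    ... | refl with bind-closure-result (v2 ∙ v1) v0 (c ∷ b ∷ a ∷ []) gx⇓v
    ... | r₂ , y , _ , ⇓app (⇓var _) (⇓var _) bc⇓r₂ , Ry , ⇓var _ , xy⇓v =
      x , y , (r₁ , ac⇓r₁ , Rx) , (r₂ , bc⇓r₂ , Ry) , xy⇓v

    S-law-reduces : ∀ {a b c v x y} → a ·ᶠ c ⇓ x → b ·ᶠ c ⇓ y → x ·ᶠ y ⇓ v →
      Σ[ s ∈ C ] Σ[ t ∈ C ] (Sᶠ ·ᶠ a ⇓ s × s ·ᶠ b ⇓ t × t ·ᶠ c ⇓ v)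
    S-law-reduces {a} {b} (r₁ , ac⇓r₁ , Rx) (r₂ , bc⇓r₂ , Ry) xy⇓v =
      _ , _ , closureᶠ-curry (ƛ S-body) [] a , closureᶠ-reduces (⇓-ƛ S-body (b ∷ a ∷ [])) ,
      bind-closure-reduces (⇓app (⇓var _) (⇓var _) ac⇓r₁) Rx (⇓-ƛ _ _)
        (bind-closure-reduces (⇓app (⇓var _) (⇓var _) bc⇓r₂) Ry (⇓var zero) xy⇓v)

  A[f] : PCA
  A[f] = record
    { Carrier = C
    ; App = _·ᶠ_⇓_
    ; App-functional = ·ᶠ-functional
    ; K = Kᶠ
    ; S = Sᶠ
    ; K-law = λ a b → _ , closureᶠ-curry v1 [] a , closureᶠ-reduces (⇓var (suc zero))
    ; S-def = λ a b → _ , _ , closureᶠ-curry (ƛ S-body) [] a , closureᶠ-reduces (⇓-ƛ S-body (b ∷ a ∷ []))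
    ; S-law = λ a b c v → (λ (s , t , Sa⇓s , sb⇓t , tc⇓v) → S-law-result Sa⇓s sb⇓t tc⇓v)
                        , (λ (x , y , ac⇓x , bc⇓y , xy⇓v) → S-law-reduces ac⇓x bc⇓y xy⇓v)
    }

  ι : AppMor A A[f]
  ι = record
    { rel = _≡_
    ; nonempty = λ a → a , refl
    ; realizer = closureᶠ (ƛᶠ (v1 ∙ v0)) [] , λ { a a' c .a .a' aa'⇓c refl refl →
        _ , c , closureᶠ-curry (v1 ∙ v0) [] a , closureᶠ-reduces (⇓app (⇓var _) (⇓var _) aa'⇓c) , refl }
    }

  ι-decidable : Decidable ι
  ι-decidable = closureᶠ (v0 ∙ con (true A[f]) ∙ con (false A[f])) [] ,
    (λ { _ refl → closureᶠ-reduces (⇓app₂ (⇓var _) (⇓con _) (⇓con _) (true-reduces _ _)) }) ,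
    (λ { _ refl → closureᶠ-reduces (⇓app₂ (⇓var _) (⇓con _) (⇓con _) (false-reduces _ _)) })

  ι-represents : Representable f ι
  ι-represents = closure (askᵗ v0 (ƛᶠ v0)) [] , λ { a fa .a a↦fa refl →
    fa , (_ , closure-reduces (⇓-ask (⇓var _) (⇓-ƛ _ _)) , run-ask a↦fa (closureᶠ-reduces (⇓var zero))) ,
    refl }

module Universal (A : PCA) (f : PartialFn A) (B : PCA) (γ : AppMor A B)
                 (γ-decidable : Decidable γ) (γ-represents : Representable f γ) where

  open Oracle A f using (Node; Run; returns; asks; binds; A[f])
  open Combinators B
  private
    module A = Combinators A
    module Af = Combinators A[f]

    C : Set
    C = Carrier B

    app : C
    app = proj₁ (realizer γ)

    ⊤̂ ⊥̂ : C
    ⊤̂ = proj₁ (nonempty γ (true A))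
    ⊥̂ = proj₁ (nonempty γ (false A))

    ⊤̂∈ : rel γ (true A) ⊤̂
    ⊤̂∈ = proj₂ (nonempty γ (true A))

    ⊥̂∈ : rel γ (false A) ⊥̂
    ⊥̂∈ = proj₂ (nonempty γ (false A))

  private variable
    n : ℕ
    ρ : Vec C n

  Codes : Vec C n → Term n → Carrier A → Set
  Codes ρ t a = Σ[ b ∈ C ] (ρ ⊢ t ⇓ b × rel γ a b)

  infixl 7 _⊛_
  _⊛_ : Term n → Term n → Term n
  t ⊛ s = con app ∙ t ∙ s

  codes-· : ∀ {t s a a' c} → App A a a' c → Codes ρ t a → Codes ρ s a' → Codes ρ (t ⊛ s) c
  codes-· aa'⇓c (b , t⇓b , b∈) (b' , s⇓b' , b'∈) with proj₂ (realizer γ) _ _ _ b b' aa'⇓c b∈ b'∈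
  ... | x , w , app·b⇓x , x·b'⇓w , w∈ = w , ⇓app₂ (⇓con app) t⇓b s⇓b' (x , app·b⇓x , x·b'⇓w) , w∈

  fst snd : Term n → Term n
  fst t = t ⊛ con ⊤̂
  snd t = t ⊛ con ⊥̂

  codes-⇓⟨⟩ : ∀ {t r x y} → r A.⇓⟨ x , y ⟩ → Codes ρ t r → Codes ρ (fst t) x × Codes ρ (snd t) y
  codes-⇓⟨⟩ (r·t⇓x , r·f⇓y) r∈ =
    codes-· r·t⇓x r∈ (_ , ⇓con ⊤̂ , ⊤̂∈) ,
    codes-· r·f⇓y r∈ (_ , ⇓con ⊥̂ , ⊥̂∈)

  test : Term n → Term n
  test t = con (proj₁ γ-decidable) ∙ t

  test-true : ∀ {t} → Codes ρ t (true A) → ρ ⊢ test t ⇓ true B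
  test-true (b , t⇓b , b∈) = ⇓app (⇓con _) t⇓b (proj₁ (proj₂ γ-decidable) b b∈)

  test-false : ∀ {t} → Codes ρ t (false A) → ρ ⊢ test t ⇓ false B
  test-false (b , t⇓b , b∈) = ⇓app (⇓con _) t⇓b (proj₂ (proj₂ γ-decidable) b b∈)

  codes-Node : ∀ {t r b x y} → Node r b x y → Codes ρ t r →
    ρ ⊢ test (fst t) ⇓ false B × Codes ρ (fst (snd t)) b ×
    Codes ρ (fst (snd (snd t))) x × Codes ρ (snd (snd (snd t))) y
  codes-Node (_ , _ , r⇓ , p⇓ , q⇓) r∈ =
    let tag∈ , p∈ = codes-⇓⟨⟩ r⇓ r∈
        b∈ , q∈ = codes-⇓⟨⟩ p⇓ p∈
        x∈ , y∈ = codes-⇓⟨⟩ q⇓ q∈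
    in test-false tag∈ , b∈ , x∈ , y∈

  codes-represents : ∀ {t x u} → graph f x u → Codes ρ t x → Codes ρ (con (proj₁ γ-represents) ∙ t) u
  codes-represents x↦u (b , t⇓b , b∈) with proj₂ γ-represents _ _ b x↦u b∈
  ... | c , φb⇓c , c∈ = c , ⇓app (⇓con _) t⇓b φb⇓c , c∈

  codes-if-true : ∀ {b t u c} → ρ ⊢ b ⇓ true B → Codes ρ t c → Codes ρ (if b then t else u) c
  codes-if-true b⇓true (w , t⇓w , w∈) = w , ⇓-if-true b⇓true t⇓w , w∈

  codes-if-false : ∀ {b t u c} → ρ ⊢ b ⇓ false B → Codes ρ u c → Codes ρ (if b then t else u) c
  codes-if-false b⇓false (w , u⇓w , w∈) = w , ⇓-if-false b⇓false u⇓w , w∈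

  -- v0 is a γ-code of the dialogue and v1 the interpreter itself.
  interpreter-body : Term 2
  interpreter-body =
    if test (fst v0) then snd v0
    else (if test (fst (snd v0)) then v1 ∙ (snd q ⊛ (con (proj₁ γ-represents) ∙ fst q))
          else v1 ∙ (snd q ⊛ (v1 ∙ fst q)))
    where
      q : Term 2
      q = snd (snd v0)

  interpreter : C
  interpreter = recursive interpreter-body

  interpret : ∀ {l t r c} → Run r c → ρ ⊢ l ⇓ interpreter → Codes ρ t r → Codes ρ (l ∙ t) c
  interpret-body : ∀ {r c β} → Run r c → rel γ r β → Codes (β ∷ interpreter ∷ []) interpreter-body c

  interpret R l⇓ (β , t⇓β , β∈) with interpret-body R β∈
  ... | w , body⇓w , w∈ = w , ⇓app l⇓ t⇓β (recursive-reduces body⇓w) , w∈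

  interpret-body (returns r⇓) β∈ =
    let tag∈ , c∈ = codes-⇓⟨⟩ r⇓ (_ , ⇓var zero , β∈)
    in codes-if-true (test-true tag∈) c∈
  interpret-body (asks n x↦u (_ , k·u⇓r , R)) β∈ =
    let tag⇓ , subtag∈ , x∈ , k∈ = codes-Node n (_ , ⇓var zero , β∈)
    in codes-if-false tag⇓ (codes-if-true (test-true subtag∈)
         (interpret R (⇓var (suc zero)) (codes-· k·u⇓r k∈ (codes-represents x↦u x∈))))
  interpret-body (binds n R₁ (_ , g·x⇓r , R)) β∈ =
    let tag⇓ , subtag∈ , r₁∈ , g∈ = codes-Node n (_ , ⇓var zero , β∈)
    in codes-if-false tag⇓ (codes-if-false (test-false subtag∈)
         (interpret R (⇓var (suc zero)) (codes-· g·x⇓r g∈ (interpret R₁ (⇓var (suc zero)) r₁∈))))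

  infixl 7 _⊛ᶠ_
  _⊛ᶠ_ : Term n → Term n → Term n
  t ⊛ᶠ s = con interpreter ∙ (t ⊛ s)

  codes-·ᶠ : ∀ {t s a a' c} → App A[f] a a' c → Codes ρ t a → Codes ρ s a' → Codes ρ (t ⊛ᶠ s) c
  codes-·ᶠ (_ , aa'⇓r , R) a∈ a'∈ = interpret R (⇓con interpreter) (codes-· aa'⇓r a∈ a'∈)

  γᶠ : AppMor A[f] B
  γᶠ = record
    { rel = rel γ
    ; nonempty = nonempty γ
    ; realizer = closure (ƛ (v1 ⊛ᶠ v0)) [] , λ a a' c b b' aa'⇓c b∈ b'∈ →
        let w , ⇓w , w∈ = codes-·ᶠ aa'⇓c (b , ⇓var (suc zero) , b∈) (b' , ⇓var zero , b'∈)
            x , realizer·b⇓x , x·b'⇓w = closure₂-reduces ⇓w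
        in x , w , realizer·b⇓x , x·b'⇓w , w∈
    }

  γᶠ-decidable : Decidable γᶠ
  γᶠ-decidable = closure (test (v0 ⊛ᶠ con ⊤̂ ⊛ᶠ con ⊥̂)) [] ,
    (λ b b∈ → closure-reduces (test-true (select (Af.true-reduces _ _) b∈))) ,
    (λ b b∈ → closure-reduces (test-false (select (Af.false-reduces _ _) b∈)))
    where
      select : ∀ {s v b} → Af._·_·_⇓_ s (true A) (false A) v → rel γ s b →
        Codes (b ∷ []) (v0 ⊛ᶠ con ⊤̂ ⊛ᶠ con ⊥̂) v
      select (_ , s·⊤⇓ , ·⊥⇓v) b∈ =
        codes-·ᶠ ·⊥⇓v (codes-·ᶠ s·⊤⇓ (_ , ⇓var zero , b∈) (_ , ⇓con ⊤̂ , ⊤̂∈))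
                 (_ , ⇓con ⊥̂ , ⊥̂∈)

module _ {X Y : PCA} where

  private
    _≈_ _≲_ _≃_ : Rel X Y → Rel X Y → Set
    _≈_ = _≡R_ {X} {Y}
    _≲_ = _≼_ {X} {Y}
    _≃_ = _≅_ {X} {Y}

  ∘R-identityʳ : (δ : Rel X Y) → _∘R_ {X} {X} {Y} δ _≡_ ≈ δ
  ∘R-identityʳ δ a b = (λ { (.a , refl , δab) → δab }) , (λ δab → a , refl , δab)

  ≡R-sym : ∀ {γ δ} → γ ≈ δ → δ ≈ γ
  ≡R-sym γ≈δ a b = proj₂ (γ≈δ a b) , proj₁ (γ≈δ a b)

  ≡R-trans : ∀ {γ δ ε} → γ ≈ δ → δ ≈ ε → γ ≈ ε
  ≡R-trans γ≈δ δ≈ε a b =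
    (λ γab → proj₁ (δ≈ε a b) (proj₁ (γ≈δ a b) γab)) , (λ εab → proj₂ (γ≈δ a b) (proj₂ (δ≈ε a b) εab))

  ≼-respˡ-≡R : ∀ {γ γ' δ} → γ ≈ γ' → γ ≲ δ → γ' ≲ δ
  ≼-respˡ-≡R γ≈γ' (s , s-maps) = s , λ a b γ'ab → s-maps a b (proj₂ (γ≈γ' a b) γ'ab)

  ≼-respʳ-≡R : ∀ {γ δ δ'} → δ ≈ δ' → γ ≲ δ → γ ≲ δ'
  ≼-respʳ-≡R δ≈δ' (s , s-maps) =
    s , λ a b γab → let c , sb⇓c , δac = s-maps a b γab in c , sb⇓c , proj₁ (δ≈δ' a c) δac

  ≅-respˡ-≡R : ∀ {γ γ' δ} → γ ≈ γ' → γ ≃ δ → γ' ≃ δ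
  ≅-respˡ-≡R γ≈γ' (γ≲δ , δ≲γ) = ≼-respˡ-≡R γ≈γ' γ≲δ , ≼-respʳ-≡R γ≈γ' δ≲γ

theorem1p2 : (A : PCA) (f : PartialFn A) →
    Σ[ Af ∈ PCA ] Σ[ ι ∈ AppMor A Af ]
      (Decidable ι × Representable f ι ×
        ((B : PCA) (γ : AppMor A B) → Decidable γ → Representable f γ →
          Σ[ γf ∈ AppMor Af B ]
            (Decidable γf
            × _≡R_ {A} {B} (_∘R_ {A} {Af} {B} (rel γf) (rel ι)) (rel γ)
            × ((δ : AppMor Af B) → _≡R_ {A} {B} (_∘R_ {A} {Af} {B} (rel δ) (rel ι)) (rel γ)
                 → _≡R_ {Af} {B} (rel δ) (rel γf))
            × ((δ : AppMor Af B) → _≅_ {A} {B} (_∘R_ {A} {Af} {B} (rel δ) (rel ι)) (rel γ)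
                 → _≅_ {Af} {B} (rel δ) (rel γf)))))
theorem1p2 A f =
  A[f] , ι , ι-decidable , ι-represents , λ B γ γ-decidable γ-represents →
    let open Universal A f B γ γ-decidable γ-represents in
    γᶠ , γᶠ-decidable , ∘R-identityʳ {A} {B} (rel γ) ,
    (λ δ δι≡γ → ≡R-trans {A} {B} (≡R-sym {A} {B} (∘R-identityʳ {A} {B} (rel δ))) δι≡γ) ,
    (λ δ δι≅γ → ≅-respˡ-≡R {A} {B} (∘R-identityʳ {A} {B} (rel δ)) δι≅γ)
  where open Oracle A f
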